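{- Let $m$ be a positive integer and $t$ an integer with $t\ge 38.73m$. Let $S$ be a set of at most $t$ vertices of $Q_t$, each of weight at least $2$. Then $Q_t$ has a vertex $w$ of weight $m$ such that $d_{Q_t}(v,w)\ge m$ for all $v\in S$.
   Context: The hypercube $Q_t$ has vertex set $\{v_S: S\subseteq\{1,\dots,t\}\}$, with $v_S$ adjacent to $v_T$ when the symmetric difference of $S$ and $T$ has size $1$; the weight of $v_S$ is $|S|$, and $d_{Q_t}$ is graph distance (equal to the size of the symmetric difference of the index sets). -}

module Defs where

open import Data.Nat using (ℕ)
open import Data.Fin.Subset using (Subset; ∣_∣; _∪_; _─_)

-- Vertex v_S of Q_t is represented by the subset S ⊆ {1..t}, as a Subset t.
Vertex : ℕ → Set
Vertex t = Subset t

weight : ∀ {t} → Vertex t → ℕ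
weight S = ∣ S ∣

dist : ∀ {t} → Vertex t → Vertex t → ℕ
dist S T = ∣ (S ─ T) ∪ (T ─ S) ∣

module Submission where

-- Proof idea: a weighted greedy choice (the method of conditional expectations).
--
-- Every v ∈ S becomes the constraint "w meets v in at most ⌊|v|/2⌋ coordinates";
-- since d(v,w) + 2|v ∩ w| = |v| + |w|, every w of weight m meeting all of these
-- constraints is at distance at least m from each v ∈ S.
-- Such a w is built by deciding its coordinates one at a time.  A partially
-- processed constraint remembers the undecided part v of its vertex, its remaining
-- budget c, and the number d of coordinates of v already put into w; it weighs
-- 2^|v| · q^d with q = r + 2.  Let X = q^T, where T ≤ c + d for every constraint.
-- If n coordinates are undecided and m of them must still be chosen, the potential
-- inequality  (r+1)·X·m + Σ weights ≤ X·n  survives one of the two possible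
-- decisions for the next coordinate: excluding it halves the weight of every
-- constraint containing it, including it multiplies that weight by q/2, and
-- r·(potential after excluding) + (potential after including) is at most
-- (r+1)·(potential now); a constraint without budget weighs at least X, so
-- excluding is affordable whenever some constraint forbids including.

open import Defs
open import Data.Nat using (ℕ; _≤_; _*_)
open import Data.List using (List; length)
open import Data.List.Membership.Propositional using (_∈_)
open import Data.Product using (∃; _×_)
open import Relation.Binary.PropositionalEquality using (_≡_)

open import Data.Bool using (true; false)
open import Data.Vec using ([]; _∷_)
open import Data.Nat using (zero; suc; _+_; _^_; _∸_; _<_; _≤?_; z≤n; s≤s; ⌊_/2⌋; ⌈_/2⌉)
open import Data.Nat.Properties
open import Data.Nat.Tactic.RingSolver using (solve-∀)
open import Data.Fin.Subset using (Subset; ∣_∣; _∩_) renaming (⊥ to ∅)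
open import Data.Fin.Subset.Properties using (∣⊥∣≡0; ∣p∩q∣≤∣q∣; ∣p∣≤n)
open import Data.List using ([]; _∷_; map)
open import Data.Nat.ListAction using (sum)
open import Data.List.Relation.Unary.All as All using (All; []; _∷_)
open import Data.List.Relation.Unary.All.Properties using (map⁺; map⁻; ¬Any⇒All¬)
open import Data.List.Relation.Unary.Any using (Any; here; there; any?)
open import Data.Product using (_,_)
open import Data.Sum using (_⊎_; inj₁; inj₂)
open import Function using (_∘_)
open import Relation.Nullary using (¬_; Dec; yes; no; contradiction)
open import Relation.Binary.PropositionalEquality using (refl; sym; trans; cong; cong₂; subst; module ≡-Reasoning)

record Constraint (n : ℕ) : Set where
  constructor ⟨_,_,_⟩
  field
    support : Subset n
    budget  : ℕ
    spent   : ℕ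

open Constraint

Satisfies : ∀ {n} → Subset n → Constraint n → Set
Satisfies w e = ∣ support e ∩ w ∣ ≤ budget e

Solution : ∀ {n} → ℕ → List (Constraint n) → Set
Solution {n} m cs = ∃ λ (w : Subset n) → ∣ w ∣ ≡ m × All (Satisfies w) cs

exclude : ∀ {n} → Constraint (suc n) → Constraint n
exclude ⟨ _ ∷ v , c , d ⟩ = ⟨ v , c , d ⟩

-- The constraint left after putting the first coordinate into w; it spends one
-- unit of budget if that coordinate lies in the support.  (A constraint that is
-- `Blocked` below cannot pay; it is then left unchanged and never used.)
include : ∀ {n} → Constraint (suc n) → Constraint n
include ⟨ true ∷ v , suc c , d ⟩ = ⟨ v , c , suc d ⟩
include ⟨ true ∷ v , zero , d ⟩ = ⟨ v , zero , d ⟩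
include ⟨ false ∷ v , c , d ⟩ = ⟨ v , c , d ⟩

data Blocked {n} : Constraint (suc n) → Set where
  no-budget : ∀ {v d} → Blocked ⟨ true ∷ v , 0 , d ⟩

blocked? : ∀ {n} (e : Constraint (suc n)) → Dec (Blocked e)
blocked? ⟨ true ∷ v , zero , d ⟩ = yes no-budget
blocked? ⟨ true ∷ v , suc c , d ⟩ = no λ ()
blocked? ⟨ false ∷ v , c , d ⟩ = no λ ()

empty-solution : ∀ {n} (cs : List (Constraint n)) → Solution 0 cs
empty-solution {n} cs = ∅ , ∣⊥∣≡0 n , All.tabulate meets-nothing
  where
  meets-nothing : ∀ {e} → e ∈ cs → Satisfies ∅ e
  meets-nothing {e} _ = ≤-trans (∣p∩q∣≤∣q∣ (support e) ∅) (≤-trans (≤-reflexive (∣⊥∣≡0 n)) z≤n)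

extend-excluded : ∀ {n m} (cs : List (Constraint (suc n))) →
  Solution m (map exclude cs) → Solution m cs
extend-excluded cs (w , size , sat) = false ∷ w , size , All.map (λ {e} → lift {e}) (map⁻ sat)
  where
  lift : ∀ {e : Constraint (suc _)} → Satisfies w (exclude e) → Satisfies (false ∷ w) e
  lift {⟨ true ∷ v , c , d ⟩} s = s
  lift {⟨ false ∷ v , c , d ⟩} s = s

extend-included : ∀ {n m} (cs : List (Constraint (suc n))) → All (¬_ ∘ Blocked) cs →
  Solution m (map include cs) → Solution (suc m) cs
extend-included cs unblocked (w , size , sat) =
  true ∷ w , cong suc size , All.zipWith (λ {e} → lift {e}) (unblocked , map⁻ sat)
  where
  lift : ∀ {e : Constraint (suc _)} → ¬ Blocked e × Satisfies w (include e) → Satisfies (true ∷ w) e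
  lift {⟨ true ∷ v , zero , d ⟩} (free , _) = contradiction no-budget free
  lift {⟨ true ∷ v , suc c , d ⟩} (_ , s) = s≤s s
  lift {⟨ false ∷ v , c , d ⟩} (_ , s) = s

-- Arithmetic core of a greedy step (a, b, s: weight sums after excluding, after
-- including, and now).
include-arith : ∀ r X m n a b s → (1 + r) * X * suc m + s ≤ X * suc n →
  b + r * a ≡ (1 + r) * s → X * n < (1 + r) * X * suc m + a →
  (1 + r) * X * m + b ≤ X * n
include-arith r X m n a b s fits balance overflow = +-cancelʳ-≤ C _ _ (begin
    (1 + r) * X * m + b + C
  ≤⟨ +-monoˡ-≤ C (m≤m+n ((1 + r) * X * m + b) r) ⟩
    (1 + r) * X * m + b + r + C
  ≡⟨ regroup r X m n a b ⟩
    (1 + r) * ((1 + r) * X * suc m) + (b + r * a) + r * suc (X * n)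
  ≡⟨ cong (λ z → (1 + r) * ((1 + r) * X * suc m) + z + r * suc (X * n)) balance ⟩
    (1 + r) * ((1 + r) * X * suc m) + (1 + r) * s + r * suc (X * n)
  ≡⟨ cong (_+ r * suc (X * n)) (sym (*-distribˡ-+ (1 + r) ((1 + r) * X * suc m) s)) ⟩
    (1 + r) * ((1 + r) * X * suc m + s) + r * suc (X * n)
  ≤⟨ +-mono-≤ (*-monoʳ-≤ (1 + r) fits) (*-monoʳ-≤ r overflow) ⟩
    (1 + r) * (X * suc n) + r * ((1 + r) * X * suc m + a)
  ≡⟨ collect r X m n a ⟩
    X * n + C ∎)
  where
  open ≤-Reasoning
  C : ℕ
  C = (1 + r) * (1 + r) * X + r * (1 + r) * X * m + r * a + r * X * n
  regroup : ∀ r X m n a b →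
    (1 + r) * X * m + b + r + ((1 + r) * (1 + r) * X + r * (1 + r) * X * m + r * a + r * X * n)
      ≡ (1 + r) * ((1 + r) * X * suc m) + (b + r * a) + r * suc (X * n)
  regroup = solve-∀
  collect : ∀ r X m n a →
    (1 + r) * (X * suc n) + r * ((1 + r) * X * suc m + a)
      ≡ X * n + ((1 + r) * (1 + r) * X + r * (1 + r) * X * m + r * a + r * X * n)
  collect = solve-∀

exclude-arith : ∀ r X m n a s → (1 + r) * X * suc m + s ≤ X * suc n → X + a ≤ s →
  (1 + r) * X * suc m + a ≤ X * n
exclude-arith r X m n a s fits drop = +-cancelˡ-≤ X _ _ (begin
    X + ((1 + r) * X * suc m + a)
  ≡⟨ +-comm-middle X ((1 + r) * X * suc m) a ⟩
    (1 + r) * X * suc m + (X + a)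
  ≤⟨ +-monoʳ-≤ ((1 + r) * X * suc m) drop ⟩
    (1 + r) * X * suc m + s
  ≤⟨ fits ⟩
    X * suc n
  ≡⟨ *-suc X n ⟩
    X + X * n ∎)
  where
  open ≤-Reasoning
  +-comm-middle : ∀ x y z → x + (y + z) ≡ y + (x + z)
  +-comm-middle = solve-∀

module Weights (r : ℕ) where

  q : ℕ
  q = 2 + r

  weightOf : ∀ {n} → Constraint n → ℕ
  weightOf ⟨ v , c , d ⟩ = 2 ^ ∣ v ∣ * q ^ d

  Φ : ∀ {n} → List (Constraint n) → ℕ
  Φ cs = sum (map weightOf cs)

  exclude-lighter : ∀ {n} (e : Constraint (suc n)) → weightOf (exclude e) ≤ weightOf e
  exclude-lighter ⟨ true ∷ v , c , d ⟩ = *-monoˡ-≤ (q ^ d) (m≤m+n (2 ^ ∣ v ∣) (2 ^ ∣ v ∣ + 0))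
  exclude-lighter ⟨ false ∷ v , c , d ⟩ = ≤-refl

  Φ-exclude-lighter : ∀ {n} (cs : List (Constraint (suc n))) → Φ (map exclude cs) ≤ Φ cs
  Φ-exclude-lighter [] = z≤n
  Φ-exclude-lighter (e ∷ cs) = +-mono-≤ (exclude-lighter e) (Φ-exclude-lighter cs)

  -- A weighted average of the two restrictions recovers the current weight:
  -- if including multiplies a weight x by q/2 and excluding halves it, then
  -- (q/2)·x + r·(x/2) = (1 + r)·x; otherwise both leave x unchanged.
  balance : ∀ {n} (e : Constraint (suc n)) → ¬ Blocked e →
    weightOf (include e) + r * weightOf (exclude e) ≡ (1 + r) * weightOf e
  balance ⟨ true ∷ v , zero , d ⟩ free = contradiction no-budget free
  balance ⟨ true ∷ v , suc c , d ⟩ _ = identity r (2 ^ ∣ v ∣) (q ^ d)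
    where
    identity : ∀ r x y → x * ((2 + r) * y) + r * (x * y) ≡ (1 + r) * ((x + (x + 0)) * y)
    identity = solve-∀
  balance ⟨ false ∷ v , c , d ⟩ _ = identity r (2 ^ ∣ v ∣ * q ^ d)
    where
    identity : ∀ r x → x + r * x ≡ (1 + r) * x
    identity = solve-∀

  Φ-balance : ∀ {n} (cs : List (Constraint (suc n))) → All (¬_ ∘ Blocked) cs →
    Φ (map include cs) + r * Φ (map exclude cs) ≡ (1 + r) * Φ cs
  Φ-balance [] [] = refl
  Φ-balance (e ∷ cs) (free ∷ frees) = begin
      (b + B) + r * (a + A)
    ≡⟨ interchange r a A b B ⟩
      (b + r * a) + (B + r * A)
    ≡⟨ cong₂ _+_ (balance e free) (Φ-balance cs frees) ⟩
      (1 + r) * weightOf e + (1 + r) * Φ cs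
    ≡⟨ sym (*-distribˡ-+ (1 + r) (weightOf e) (Φ cs)) ⟩
      (1 + r) * (weightOf e + Φ cs) ∎
    where
    open ≡-Reasoning
    a A b B : ℕ
    a = weightOf (exclude e)
    A = Φ (map exclude cs)
    b = weightOf (include e)
    B = Φ (map include cs)
    interchange : ∀ r a A b B → (b + B) + r * (a + A) ≡ (b + r * a) + (B + r * A)
    interchange = solve-∀

  module Greedy (T : ℕ) where

    X : ℕ
    X = q ^ T

    Tight : ∀ {n} → Constraint n → Set
    Tight e = T ≤ budget e + spent e

    Within : ∀ {n} → ℕ → List (Constraint n) → Set
    Within {n} m cs = (1 + r) * X * m + Φ cs ≤ X * n

    -- Tightness survives both restrictions (including moves one unit from
    -- budget to spent).
    tight-exclude : ∀ {n} {cs : List (Constraint (suc n))} → All Tight cs → All Tight (map exclude cs)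
    tight-exclude = map⁺ ∘ All.map (λ {e} → keep {e = e})
      where
      keep : ∀ {n} {e : Constraint (suc n)} → Tight e → Tight (exclude e)
      keep {e = ⟨ _ ∷ v , c , d ⟩} t = t

    tight-include : ∀ {n} {cs : List (Constraint (suc n))} → All (¬_ ∘ Blocked) cs →
      All Tight cs → All Tight (map include cs)
    tight-include frees tights = map⁺ (All.zipWith (λ {e} → keep {e = e}) (frees , tights))
      where
      keep : ∀ {n} {e : Constraint (suc n)} → ¬ Blocked e × Tight e → Tight (include e)
      keep {e = ⟨ true ∷ v , zero , d ⟩} (free , _) = contradiction no-budget free
      keep {e = ⟨ true ∷ v , suc c , d ⟩} (_ , t) = subst (T ≤_) (sym (+-suc c d)) t
      keep {e = ⟨ false ∷ v , c , d ⟩} (_ , t) = t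

    -- A tight blocked constraint has spent ≥ T, so excluding its first
    -- coordinate removes at least q^T = X from its weight.
    blocked-heavy : ∀ {n} {e : Constraint (suc n)} → Tight e → Blocked e →
      X + weightOf (exclude e) ≤ weightOf e
    blocked-heavy {e = ⟨ true ∷ v , 0 , d ⟩} T≤d no-budget = begin
        q ^ T + 2 ^ ∣ v ∣ * q ^ d
      ≤⟨ +-monoˡ-≤ _ (≤-trans (^-monoʳ-≤ q T≤d) (m≤n*m (q ^ d) (2 ^ ∣ v ∣) {{m^n≢0 2 ∣ v ∣}})) ⟩
        2 ^ ∣ v ∣ * q ^ d + 2 ^ ∣ v ∣ * q ^ d
      ≡⟨ double (2 ^ ∣ v ∣) (q ^ d) ⟩
        2 ^ suc ∣ v ∣ * q ^ d ∎
      where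
      open ≤-Reasoning
      double : ∀ x y → x * y + x * y ≡ (x + (x + 0)) * y
      double = solve-∀

    Φ-blocked : ∀ {n} {cs : List (Constraint (suc n))} → All Tight cs → Any Blocked cs →
      X + Φ (map exclude cs) ≤ Φ cs
    Φ-blocked {cs = e ∷ cs} (t ∷ _) (here b) =
      subst (_≤ weightOf e + Φ cs) (+-assoc X _ _)
        (+-mono-≤ (blocked-heavy t b) (Φ-exclude-lighter cs))
    Φ-blocked {cs = e ∷ cs} (_ ∷ ts) (there b) =
      subst (_≤ weightOf e + Φ cs) (swap X (weightOf (exclude e)) (Φ (map exclude cs)))
        (+-mono-≤ (exclude-lighter e) (Φ-blocked ts b))
      where
      swap : ∀ x y z → y + (x + z) ≡ x + (y + z)
      swap = solve-∀

    no-room : ∀ m s → ¬ ((1 + r) * X * suc m + s ≤ X * 0)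
    no-room m s fits = n≮0 (begin-strict
        0
      <⟨ m^n>0 q T ⟩
        X
      ≤⟨ m≤n*m X (1 + r) ⟩
        (1 + r) * X
      ≤⟨ m≤m*n ((1 + r) * X) (suc m) ⟩
        (1 + r) * X * suc m
      ≤⟨ m≤m+n _ s ⟩
        (1 + r) * X * suc m + s
      ≤⟨ fits ⟩
        X * 0
      ≡⟨ *-zeroʳ X ⟩
        0 ∎)
      where open ≤-Reasoning

    step : ∀ {n} m (cs : List (Constraint (suc n))) → All Tight cs → Within (suc m) cs →
      Within (suc m) (map exclude cs) ⊎ (All (¬_ ∘ Blocked) cs × Within m (map include cs))
    step {n} m cs tights fits with (1 + r) * X * suc m + Φ (map exclude cs) ≤? X * n
    ... | yes fits-excluded = inj₁ fits-excluded
    ... | no overflow = inj₂ (unblocked , include-arith r X m n _ _ (Φ cs)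
                                           fits (Φ-balance cs unblocked) (≰⇒> overflow))
      where
      unblocked : All (¬_ ∘ Blocked) cs
      unblocked with any? blocked? cs
      ... | yes b = contradiction (exclude-arith r X m n _ _ fits (Φ-blocked tights b)) overflow
      ... | no nb = ¬Any⇒All¬ cs nb

    greedy : ∀ n m (cs : List (Constraint n)) → All Tight cs → Within m cs → Solution m cs
    greedy n zero cs _ _ = empty-solution cs
    greedy zero (suc m) cs _ fits = contradiction fits (no-room m (Φ cs))
    greedy (suc n) (suc m) cs tights fits with step m cs tights fits
    ... | inj₁ fits′ =
      extend-excluded cs (greedy n (suc m) (map exclude cs) (tight-exclude tights) fits′)
    ... | inj₂ (unblocked , fits′) =
      extend-included cs unblocked (greedy n m (map include cs) (tight-include unblocked tights) fits′)

-- The hypercube application uses base q = 17, i.e. r = 15, and T = t.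
open Weights 15

vertexConstraint : ∀ {t} → Vertex t → Constraint t
vertexConstraint {t} v = ⟨ v , ⌊ ∣ v ∣ /2⌋ , t ∸ ⌊ ∣ v ∣ /2⌋ ⟩

-- Budget plus spent equals t, so vertex constraints are tight for T = t.
half-weight≤t : ∀ {t} (v : Vertex t) → ⌊ ∣ v ∣ /2⌋ ≤ t
half-weight≤t v = ≤-trans (⌊n/2⌋≤n ∣ v ∣) (∣p∣≤n v)

vertexConstraint-tight : ∀ {t} (v : Vertex t) → Greedy.Tight t (vertexConstraint v)
vertexConstraint-tight v = ≤-reflexive (sym (m+[n∸m]≡n (half-weight≤t v)))

-- The numerical heart of the constant: 2^k grows slower than 17^(k/2).
two-powers : ∀ k → 2 ≤ k → 17 * 2 ^ k ≤ 8 * 17 ^ ⌊ k /2⌋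
two-powers 1 (s≤s ())
two-powers 2 _ = m≤m+n 68 68
two-powers 3 _ = ≤-refl
two-powers (suc (suc (suc (suc k)))) _ = begin
    17 * 2 ^ (4 + k)
  ≡⟨ quadruple (2 ^ (2 + k)) ⟩
    4 * (17 * 2 ^ (2 + k))
  ≤⟨ *-monoʳ-≤ 4 (two-powers (suc (suc k)) (s≤s (s≤s z≤n))) ⟩
    4 * (8 * 17 ^ ⌊ 2 + k /2⌋)
  ≤⟨ *-monoˡ-≤ (8 * 17 ^ ⌊ 2 + k /2⌋) (m≤m+n 4 13) ⟩
    17 * (8 * 17 ^ ⌊ 2 + k /2⌋)
  ≡⟨ reorder (17 ^ ⌊ 2 + k /2⌋) ⟩
    8 * 17 ^ ⌊ 4 + k /2⌋ ∎
  where
  open ≤-Reasoning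
  quadruple : ∀ x → 17 * (2 * (2 * x)) ≡ 4 * (17 * x)
  quadruple = solve-∀
  reorder : ∀ y → 17 * (8 * y) ≡ 8 * (17 * y)
  reorder = solve-∀

vertex-weight : ∀ {t} (v : Vertex t) → 2 ≤ ∣ v ∣ → 17 * weightOf (vertexConstraint v) ≤ 8 * 17 ^ t
vertex-weight {t} v heavy = begin
    17 * (2 ^ ∣ v ∣ * 17 ^ (t ∸ h))
  ≡⟨ sym (*-assoc 17 (2 ^ ∣ v ∣) (17 ^ (t ∸ h))) ⟩
    17 * 2 ^ ∣ v ∣ * 17 ^ (t ∸ h)
  ≤⟨ *-monoˡ-≤ (17 ^ (t ∸ h)) (two-powers ∣ v ∣ heavy) ⟩
    8 * 17 ^ h * 17 ^ (t ∸ h)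
  ≡⟨ *-assoc 8 (17 ^ h) (17 ^ (t ∸ h)) ⟩
    8 * (17 ^ h * 17 ^ (t ∸ h))
  ≡⟨ cong (8 *_) (sym (^-distribˡ-+-* 17 h (t ∸ h))) ⟩
    8 * 17 ^ (h + (t ∸ h))
  ≡⟨ cong (λ e → 8 * 17 ^ e) (m+[n∸m]≡n (half-weight≤t v)) ⟩
    8 * 17 ^ t ∎
  where
  open ≤-Reasoning
  h : ℕ
  h = ⌊ ∣ v ∣ /2⌋

Φ-vertices : ∀ {t} (S : List (Vertex t)) → (∀ v → v ∈ S → 2 ≤ weight v) →
  17 * Φ (map vertexConstraint S) ≤ 8 * 17 ^ t * length S
Φ-vertices [] _ = z≤n
Φ-vertices {t} (v ∷ S) heavy = begin
    17 * (weightOf (vertexConstraint v) + Φ (map vertexConstraint S))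
  ≡⟨ *-distribˡ-+ 17 (weightOf (vertexConstraint v)) (Φ (map vertexConstraint S)) ⟩
    17 * weightOf (vertexConstraint v) + 17 * Φ (map vertexConstraint S)
  ≤⟨ +-mono-≤ (vertex-weight v (heavy v (here refl)))
              (Φ-vertices S (λ u u∈S → heavy u (there u∈S))) ⟩
    8 * 17 ^ t + 8 * 17 ^ t * length S
  ≡⟨ sym (*-suc (8 * 17 ^ t) (length S)) ⟩
    8 * 17 ^ t * suc (length S) ∎
  where open ≤-Reasoning

density : ∀ m t → 3873 * m ≤ 100 * t → 272 * m ≤ 9 * t
density m t dense = *-cancelˡ-≤ 100 (begin
    100 * (272 * m)
  ≡⟨ sym (*-assoc 100 272 m) ⟩
    27200 * m
  ≤⟨ *-monoˡ-≤ m (m≤m+n 27200 7657) ⟩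
    34857 * m
  ≡⟨ *-assoc 9 3873 m ⟩
    9 * (3873 * m)
  ≤⟨ *-monoʳ-≤ 9 dense ⟩
    9 * (100 * t)
  ≡⟨ reorder t ⟩
    100 * (9 * t) ∎)
  where
  open ≤-Reasoning
  reorder : ∀ t → 9 * (100 * t) ≡ 100 * (9 * t)
  reorder = solve-∀

initial-within : ∀ m t (S : List (Vertex t)) → 3873 * m ≤ 100 * t → length S ≤ t →
  (∀ v → v ∈ S → 2 ≤ weight v) → Greedy.Within t m (map vertexConstraint S)
initial-within m t S dense short heavy = *-cancelˡ-≤ 17 (begin
    17 * (16 * X * m + Φ (map vertexConstraint S))
  ≡⟨ expand X m (Φ (map vertexConstraint S)) ⟩
    X * (272 * m) + 17 * Φ (map vertexConstraint S)
  ≤⟨ +-mono-≤ (*-monoʳ-≤ X (density m t dense))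
              (≤-trans (Φ-vertices S heavy) (*-monoʳ-≤ (8 * X) short)) ⟩
    X * (9 * t) + 8 * X * t
  ≡⟨ collect X t ⟩
    17 * (X * t) ∎)
  where
  open ≤-Reasoning
  X : ℕ
  X = 17 ^ t
  expand : ∀ X m s → 17 * (16 * X * m + s) ≡ X * (272 * m) + 17 * s
  expand = solve-∀
  collect : ∀ X t → X * (9 * t) + 8 * X * t ≡ 17 * (X * t)
  collect = solve-∀

dist-intersection : ∀ {n} (v w : Subset n) → dist v w + 2 * ∣ v ∩ w ∣ ≡ ∣ v ∣ + ∣ w ∣
dist-intersection [] [] = refl
dist-intersection (true ∷ v) (true ∷ w) = begin
    dist v w + 2 * suc ∣ v ∩ w ∣
  ≡⟨ cong (dist v w +_) (*-suc 2 ∣ v ∩ w ∣) ⟩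
    dist v w + (2 + 2 * ∣ v ∩ w ∣)
  ≡⟨ +-comm-middle (dist v w) 2 (2 * ∣ v ∩ w ∣) ⟩
    2 + (dist v w + 2 * ∣ v ∩ w ∣)
  ≡⟨ cong (2 +_) (dist-intersection v w) ⟩
    2 + (∣ v ∣ + ∣ w ∣)
  ≡⟨ cong suc (sym (+-suc ∣ v ∣ ∣ w ∣)) ⟩
    suc ∣ v ∣ + suc ∣ w ∣ ∎
  where
  open ≡-Reasoning
  +-comm-middle : ∀ x y z → x + (y + z) ≡ y + (x + z)
  +-comm-middle = solve-∀
dist-intersection (true ∷ v) (false ∷ w) = cong suc (dist-intersection v w)
dist-intersection (false ∷ v) (true ∷ w) =
  trans (cong suc (dist-intersection v w)) (sym (+-suc ∣ v ∣ ∣ w ∣))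
dist-intersection (false ∷ v) (false ∷ w) = dist-intersection v w

far-if-half-met : ∀ {n} (v w : Subset n) → ∣ v ∩ w ∣ ≤ ⌊ ∣ v ∣ /2⌋ → ∣ w ∣ ≤ dist v w
far-if-half-met v w met = +-cancelˡ-≤ ∣ v ∣ _ _ (begin
    ∣ v ∣ + ∣ w ∣
  ≡⟨ sym (dist-intersection v w) ⟩
    dist v w + 2 * ∣ v ∩ w ∣
  ≤⟨ +-monoʳ-≤ (dist v w) (≤-trans (*-monoʳ-≤ 2 met) (double-half≤ ∣ v ∣)) ⟩
    dist v w + ∣ v ∣
  ≡⟨ +-comm (dist v w) ∣ v ∣ ⟩
    ∣ v ∣ + dist v w ∎)
  where
  open ≤-Reasoning
  double-half≤ : ∀ k → 2 * ⌊ k /2⌋ ≤ k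
  double-half≤ k = begin
      ⌊ k /2⌋ + (⌊ k /2⌋ + 0)
    ≡⟨ cong (⌊ k /2⌋ +_) (+-identityʳ ⌊ k /2⌋) ⟩
      ⌊ k /2⌋ + ⌊ k /2⌋
    ≤⟨ +-monoʳ-≤ ⌊ k /2⌋ (⌊n/2⌋≤⌈n/2⌉ k) ⟩
      ⌊ k /2⌋ + ⌈ k /2⌉
    ≡⟨ ⌊n/2⌋+⌈n/2⌉≡n k ⟩
      k ∎

far-from-all : ∀ {t m} (S : List (Vertex t)) → Solution m (map vertexConstraint S) →
  ∃ λ (w : Vertex t) → weight w ≡ m × (∀ v → v ∈ S → m ≤ dist v w)
far-from-all S (w , size , sat) =
  w , size , λ v v∈S → subst (_≤ dist v w) size (far-if-half-met v w (All.lookup (map⁻ sat) v∈S))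

lemma4p4 : (m t : ℕ) → 1 ≤ m → 3873 * m ≤ 100 * t →
    (S : List (Vertex t)) → length S ≤ t → (∀ v → v ∈ S → 2 ≤ weight v) →
    ∃ λ (w : Vertex t) → weight w ≡ m × (∀ v → v ∈ S → m ≤ dist v w)
lemma4p4 m t _ dense S short heavy = far-from-all S
  (Greedy.greedy t t m (map vertexConstraint S)
    (map⁺ (All.tabulate λ {v} _ → vertexConstraint-tight v))
    (initial-within m t S dense short heavy))
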